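{- Let $C$ be an edge-weighted ring of order $n\ge 3$ with vertices $v_0,\dots,v_{n-1}$, edges $e_i=(v_i,v_{i+1})$ for $i\in\{0,\dots,n-2\}$ and $e_{n-1}=(v_{n-1},v_0)$, positive weights, homebase $v_0$, and let $q\ge 0$ be any invoking cost. Then the strategy $\mathcal{S}$ returned by the procedure $\mathtt{RingOffline}$ (described in the context) on input $C$, $v_0$, $q$ is cost-optimal for exploring $C$.
   Context: Exploration model: let $G=(V,E,w)$ be a connected undirected graph with edge weights $w:E\to\mathbb{R}^+$, a designated vertex $h$ (the homebase), and an invoking cost $q\in\mathbb{R}^+\cup\{0\}$. A strategy is a sequence of moves, each of which is either (1) invoking a new agent, which appears at $h$, or (2) an agent currently at a vertex $u$ traversing an edge $(u,v)$ to $v$. The number of agents that may be invoked is unbounded, and agents need not return to $h$. A vertex is explored when it is reached by an agent for the first time; the strategy explores $G$ if every vertex is visited by at least one agent. If a strategy invokes $k$ agents and the $i$-th agent traverses total distance $d_i$ (sum of weights of traversed edges, with multiplicity), its cost is $kq+\sum_{i=1}^k d_i$. A strategy is cost-optimal if it explores $G$ and has minimum cost among all strategies exploring $G$. For a subgraph $H$, $w(H)$ is the sum of weights of its edges; $d_H(u,v)$ is the distance in $H$ (weight of a shortest path), and $P_H(u,v)$ denotes the path between $u$ and $v$ in a tree/path $H$. Procedure $\mathtt{RingOffline}$ (input ring $C$, homebase $v_0$, cost $q$): let $C_i=C\setminus e_i$ for $i\in\{0,\dots,n-1\}$ (a path). For $i\in\{1,\dots,n-2\}$ let $v_i^{min}$,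 $v_i^{max}$ be the vertex of $\{v_i,v_{i+1}\}$ with minimum, respectively maximum, value of $d_{C_i}(v_0,\cdot)$. Set $c_i=q+w(C_i)$ for $i\in\{0,n-1\}$, and $c_i=\min\{2q+w(C_i),\,q+d_{C_i}(v_0,v_i^{min})+w(C_i)\}$ for $i\in\{1,\dots,n-2\}$. Let $i_{min}$ be an index minimizing $c_i$. Invoke an agent $a_1$ at $v_0$. If $i_{min}=0$, $a_1$ traverses the path $P_{C_{i_{min}}}(v_0,v_1)$. If $i_{min}=n-1$, $a_1$ traverses $P_{C_{i_{min}}}(v_0,v_{n-1})$. Otherwise, writing $i=i_{min}$: if $2q+w(C_i)<q+d_{C_i}(v_0,v_i^{min})+w(C_i)$, then $a_1$ traverses $P_{C_i}(v_0,v_i^{min})$, a second agent $a_2$ is invoked at $v_0$ and traverses $P_{C_i}(v_0,v_i^{max})$; else $a_1$ traverses $P_{C_i}(v_0,v_i^{min})$ and then $P_{C_i}(v_i^{min},v_i^{max})$. The procedure returns the resulting sequence of moves.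
   Formalization: The edge weights are positive rationals and the invoking cost $q$ is a nonnegative rational, rather than real numbers. -}

module Defs where

open import Data.Nat as ℕ using (ℕ; zero; suc; NonZero; _∸_; _≡ᵇ_)
open import Data.Nat.DivMod using (_mod_)
open import Data.Fin using (Fin; toℕ)
open import Data.Fin.Properties using () renaming (_≟_ to _≟ᶠ_)
open import Data.Rational using (ℚ; 0ℚ; _+_; _-_; _⊓_; _≤_; _<_)
open import Data.Rational.Properties using (_<?_)
open import Data.List using (List; []; _∷_; _++_; map; upTo; foldr; reverse)
open import Data.List.Relation.Unary.Any using (Any)
open import Data.List.Membership.Propositional using (_∈_)
open import Data.Maybe using (Maybe; just; nothing; _>>=_)
open import Data.Bool using (Bool; true; false; if_then_else_)
open import Data.Product using (Σ; _×_)
open import Relation.Nullary using (does; yes; no)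
open import Relation.Binary.PropositionalEquality using (_≡_)

-- Ring C with vertices v_0..v_{n-1} (elements of Fin n), edge e_k joins
-- v_k and v_{(k+1) mod n}, weight w k; homebase v_0; invoking cost q.
module Ring (n : ℕ) .{{_ : NonZero n}} (w : Fin n → ℚ) (q : ℚ) where

  V : ℕ → Fin n
  V k = k mod n

  nextV : Fin n → Fin n
  nextV k = V (suc (toℕ k))

  data Move : Set where
    invoke   : Move
    traverse : ℕ → Fin n → Move     -- agent number a (0-based, in order of
                                    -- invocation) traverses edge e_k

  -- a configuration: positions of the agents invoked so far, in order
  Config : Set
  Config = List (Fin n)

  at : Config → ℕ → Maybe (Fin n)
  at []       _       = nothing
  at (x ∷ xs) zero    = just x
  at (x ∷ xs) (suc a) = at xs a

  setAt : Config → ℕ → Fin n → Config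
  setAt []       _       _ = []
  setAt (x ∷ xs) zero    y = y ∷ xs
  setAt (x ∷ xs) (suc a) y = x ∷ setAt xs a y

  across : Fin n → Fin n → Maybe (Fin n)
  across k p with p ≟ᶠ k
  ... | yes _ = just (nextV k)
  ... | no _ with p ≟ᶠ nextV k
  ...   | yes _ = just k
  ...   | no _  = nothing

  step : Config → Move → Maybe Config
  step c invoke = just (c ++ (V 0 ∷ []))
  step c (traverse a k) =
    at c a >>= λ p → across k p >>= λ p' → just (setAt c a p')

  run : Config → List Move → Maybe (List Config)
  run c []       = just (c ∷ [])
  run c (m ∷ ms) = step c m >>= λ c' → run c' ms >>= λ tr → just (c ∷ tr)

  Explores : List Move → Set
  Explores ms = Σ (List Config) λ tr →
    (run [] ms ≡ just tr) × ((v : Fin n) → Any (λ c → v ∈ c) tr)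

  moveCost : Move → ℚ
  moveCost invoke         = q
  moveCost (traverse _ k) = w k

  cost : List Move → ℚ
  cost ms = foldr (λ m r → moveCost m + r) 0ℚ ms

  CostOptimal : List Move → Set
  CostOptimal s = Explores s × ((s' : List Move) → Explores s' → cost s ≤ cost s')

  wN : ℕ → ℚ
  wN k = w (V k)

  sumW : ℕ → ℕ → ℚ
  sumW a b = foldr (λ k r → wN (a ℕ.+ k) + r) 0ℚ (upTo (b ∸ a))

  total : ℚ
  total = sumW 0 n

  wC : Fin n → ℚ
  wC i = total - w i

  -- d_{C_i}(v_0, v_i) and d_{C_i}(v_0, v_{i+1})
  dLo : Fin n → ℚ
  dLo i = sumW 0 (toℕ i)

  dHi : Fin n → ℚ
  dHi i = sumW (suc (toℕ i)) n

  isEnd : Fin n → Bool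
  isEnd i = (toℕ i ≡ᵇ 0) Data.Bool.∨ (toℕ i ≡ᵇ (n ∸ 1))

  c : Fin n → ℚ
  c i = if isEnd i then q + wC i
        else ((q + q + wC i) ⊓ (q + (dLo i ⊓ dHi i) + wC i))

  lowEdges : Fin n → List (Fin n)
  lowEdges i = map V (upTo (toℕ i))

  highEdges : Fin n → List (Fin n)
  highEdges i = map (λ k → V (n ∸ suc k)) (upTo (n ∸ suc (toℕ i)))

  walk : ℕ → List (Fin n) → List Move
  walk a es = map (traverse a) es

  -- the choice of v_i^min : false = v_i, true = v_{i+1}
  ValidMinChoice : Fin n → Bool → Set
  ValidMinChoice i false = dLo i ≤ dHi i
  ValidMinChoice i true  = dHi i ≤ dLo i

  -- RingOffline, with i = i_min and b = the choice of v_i^min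
  -- (tie-breaking choices of the procedure made explicit)
  ringOffline : Fin n → Bool → List Move
  ringOffline i b =
    if toℕ i ≡ᵇ 0 then invoke ∷ walk 0 (highEdges i)
    else if toℕ i ≡ᵇ (n ∸ 1) then invoke ∷ walk 0 (lowEdges i)
    else (if does ((q + q + wC i) <? (q + dmin + wC i))
          then invoke ∷ walk 0 minP ++ (invoke ∷ walk 1 maxP)
          else invoke ∷ walk 0 (minP ++ reverse minP ++ maxP))
    where
      minP : List (Fin n)
      minP = if b then highEdges i else lowEdges i
      maxP : List (Fin n)
      maxP = if b then lowEdges i else highEdges i
      dmin : ℚ
      dmin = if b then dHi i else dLo i

module Submission where

open import Defs
open import Data.Nat using (ℕ; NonZero; _≤_)
open import Data.Fin using (Fin)
open import Data.Bool using (Bool)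
open import Data.Rational using (ℚ; 0ℚ) renaming (_≤_ to _≤ℚ_; _<_ to _<ℚ_)

open import Data.Nat as ℕ using (zero; suc; _∸_; _%_; z≤n; s≤s)
import Data.Nat.Properties as ℕP
open import Data.Nat.DivMod using (m<n⇒m%n≡m; n%n≡0)
open import Data.Fin using (toℕ; fromℕ<)
open import Data.Fin.Properties using (toℕ-injective; toℕ-fromℕ<; toℕ<n) renaming (_≟_ to _≟ᶠ_)
open import Data.Rational using (_+_; _-_; -_; _⊓_)
import Data.Rational.Properties as ℚP
open import Data.Rational.Properties using (_<?_)
open import Data.Rational.Solver using (module +-*-Solver)
open import Data.List using (List; []; _∷_; _++_; applyUpTo; foldr; reverse)
import Data.List.Properties as LP
open import Data.List.Relation.Unary.All as All using (All; []; _∷_)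
import Data.List.Relation.Unary.All.Properties as AllP
open import Data.List.Relation.Unary.Any using (Any; here; there)
open import Data.List.Membership.Propositional using (_∈_)
open import Data.Maybe using (just; _>>=_)
open import Data.Maybe.Properties using (just-injective)
open import Data.Product using (Σ; _×_; _,_; proj₂)
open import Data.Sum using (_⊎_; inj₁; inj₂; [_,_]′; swap)
open import Data.Empty using (⊥-elim)
open import Data.Bool using (true; false; if_then_else_; T)
open import Data.Bool.Properties using (if-float)
open import Data.Unit using (tt)
open import Relation.Nullary using (Dec; yes; no; ¬_; does)
open import Relation.Binary.PropositionalEquality
open import Function using (_∘_)

-- Upper bound: every strategy RingOffline can output traverses the path C_i = C ∖ e_i, either with
-- one agent (which may first go out to v_i^min and back) or with two agents, one towards each end,
-- and its cost is exactly c_i.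
--
-- Lower bound: along any strategy, the explored vertices form two arcs v_0 … v_α and
-- v_{n-β} … v_n = v_0 around the homebase; let Φ be their weight. As long as a single agent is
-- out, at distance d from home inside the explored arcs, it has paid at least q + 2Φ − d, because
-- every explored edge off its way home was walked twice; once a second agent is invoked, at least
-- 2q + Φ has been paid. A move along an edge of weight w_k raises Φ and 2Φ − d by at most w_k.
-- When the last vertex is reached, only e_α is unexplored, so Φ = w(C_α), and the two bounds become
-- 2q + w(C_α) and q + min(d_{C_α}(v_0, v_α), d_{C_α}(v_0, v_{α+1})) + w(C_α), both at least c_α.

x≤x+y : ∀ x {y} → 0ℚ ≤ℚ y → x ≤ℚ x + y
x≤x+y x {y} 0≤y = ℚP.≤-trans (ℚP.≤-reflexive (sym (ℚP.+-identityʳ x))) (ℚP.+-monoʳ-≤ x 0≤y)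

x≤y+x : ∀ x {y} → 0ℚ ≤ℚ y → x ≤ℚ y + x
x≤y+x x {y} 0≤y = ℚP.≤-trans (x≤x+y x 0≤y) (ℚP.≤-reflexive (ℚP.+-comm x y))

x+y≤z⇒x+y'≤z+w : ∀ x {y y' z w} → x + y ≤ℚ z → y' ≤ℚ y + w → x + y' ≤ℚ z + w
x+y≤z⇒x+y'≤z+w x {y} {y'} {z} {w} x+y≤z y'≤y+w = begin
  x + y'        ≤⟨ ℚP.+-monoʳ-≤ x y'≤y+w ⟩
  x + (y + w)   ≡⟨ sym (ℚP.+-assoc x y w) ⟩
  x + y + w     ≤⟨ ℚP.+-monoˡ-≤ w x+y≤z ⟩
  z + w         ∎
  where open ℚP.≤-Reasoning

m+[a+b]≤[a+b]+[a+b]-d : ∀ {a b m d} → m ≤ℚ b → d ≤ℚ a → m + (a + b) ≤ℚ (a + b) + (a + b) - d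
m+[a+b]≤[a+b]+[a+b]-d {a} {b} {m} {d} m≤b d≤a = begin
  m + (a + b)               ≤⟨ ℚP.+-monoˡ-≤ (a + b) m≤b ⟩
  b + (a + b)               ≡⟨ solve 2 (λ a b → b :+ (a :+ b) := (a :+ b) :+ (a :+ b) :- a) refl a b ⟩
  (a + b) + (a + b) - a     ≤⟨ ℚP.+-monoʳ-≤ ((a + b) + (a + b)) (ℚP.neg-antimono-≤ d≤a) ⟩
  (a + b) + (a + b) - d     ∎
  where open ℚP.≤-Reasoning
        open +-*-Solver

if-<?≡⊓ : ∀ {x y} (x<?y : Dec (x <ℚ y)) → (if does x<?y then x else y) ≡ x ⊓ y
if-<?≡⊓ (yes x<y) = sym (ℚP.p≤q⇒p⊓q≡p (ℚP.<⇒≤ x<y))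
if-<?≡⊓ (no x≮y)  = sym (ℚP.p≥q⇒p⊓q≡q (ℚP.≮⇒≥ x≮y))

≡ᵇ⇒≡ : ∀ {x y} → (x ℕ.≡ᵇ y) ≡ true → x ≡ y
≡ᵇ⇒≡ {x} {y} eq = ℕP.≡ᵇ⇒≡ x y (subst T (sym eq) tt)

-- Writing n = 2 + M builds in n ≥ 2, which is all the argument needs; N = n - 1 is the last index.
module RingExploration (M : ℕ) (w : Fin (suc (suc M)) → ℚ) (q : ℚ) where

  N n : ℕ
  N = suc M
  n = suc N

  open Ring n w q

  toℕ-V< : ∀ {k} → k ℕ.< n → toℕ (V k) ≡ k
  toℕ-V< {k} k<n = trans (toℕ-fromℕ< _) (m<n⇒m%n≡m k<n)

  V-toℕ : ∀ p → V (toℕ p) ≡ p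
  V-toℕ p = toℕ-injective (toℕ-V< (toℕ<n p))

  V-n : V n ≡ V 0
  V-n = toℕ-injective (trans (toℕ-fromℕ< _) (n%n≡0 n))

  nextV-V : ∀ {k} → k ℕ.< n → nextV (V k) ≡ V (suc k)
  nextV-V k<n = cong (λ k → V (suc k)) (toℕ-V< k<n)

  nextV-last : nextV (V N) ≡ V 0
  nextV-last = trans (nextV-V ℕP.≤-refl) V-n

  toℕ-nextV : ∀ k → toℕ (nextV k) ≡ suc (toℕ k) ⊎ (toℕ k ≡ N × toℕ (nextV k) ≡ 0)
  toℕ-nextV k with ℕP.m≤n⇒m<n∨m≡n (ℕP.≤-pred (toℕ<n k))
  ... | inj₁ k<N = inj₁ (toℕ-V< (s≤s k<N))
  ... | inj₂ k≡N = inj₂ (k≡N , trans (toℕ-fromℕ< _) (trans (cong (λ k → suc k % n) k≡N) (n%n≡0 n)))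

  nextV≢ : ∀ k → nextV k ≢ k
  nextV≢ k eq with toℕ-nextV k
  ... | inj₁ next          = ℕP.1+n≢n (trans (sym next) (cong toℕ eq))
  ... | inj₂ (last , next) with () ← trans (sym next) (trans (cong toℕ eq) last)

  across-forward : ∀ k → across k k ≡ just (nextV k)
  across-forward k with k ≟ᶠ k
  ... | yes _  = refl
  ... | no k≢k = ⊥-elim (k≢k refl)

  across-backward : ∀ k → across k (nextV k) ≡ just k
  across-backward k with nextV k ≟ᶠ k
  ... | yes eq = ⊥-elim (nextV≢ k eq)
  ... | no _ with nextV k ≟ᶠ nextV k
  ...   | yes _ = refl
  ...   | no ≢  = ⊥-elim (≢ refl)

  across⁻ : ∀ {k p p'} → across k p ≡ just p' → (p ≡ k × p' ≡ nextV k) ⊎ (p ≡ nextV k × p' ≡ k)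
  across⁻ {k} {p} eq with p ≟ᶠ k
  ... | yes refl = inj₁ (refl , sym (just-injective eq))
  ... | no _ with p ≟ᶠ nextV k
  ...   | yes refl = inj₂ (refl , sym (just-injective eq))
  across⁻ () | no _ | no _

  across-sym : ∀ {k p p'} → across k p ≡ just p' → across k p' ≡ just p
  across-sym {k} {p} {p'} eq with across⁻ {k} {p} {p'} eq
  ... | inj₁ (refl , refl) = across-backward k
  ... | inj₂ (refl , refl) = across-forward k

  at-∈ : ∀ cf {a p} → at cf a ≡ just p → p ∈ cf
  at-∈ (x ∷ cf) {zero}  refl = here refl
  at-∈ (x ∷ cf) {suc a} eq   = there (at-∈ cf eq)

  at-setAt : ∀ cf {a p} p' → at cf a ≡ just p → at (setAt cf a p') a ≡ just p'
  at-setAt (x ∷ cf) {zero}  p' _  = refl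
  at-setAt (x ∷ cf) {suc a} p' eq = at-setAt cf p' eq

  setAt-at : ∀ cf {a p} → at cf a ≡ just p → setAt cf a p ≡ cf
  setAt-at (x ∷ cf) {zero}  refl = refl
  setAt-at (x ∷ cf) {suc a} eq   = cong (x ∷_) (setAt-at cf eq)

  setAt-setAt : ∀ cf a p p' → setAt (setAt cf a p) a p' ≡ setAt cf a p'
  setAt-setAt []       a       p p' = refl
  setAt-setAt (x ∷ cf) zero    p p' = refl
  setAt-setAt (x ∷ cf) (suc a) p p' = cong (x ∷_) (setAt-setAt cf a p p')

  setAt⁺ : ∀ {P : Fin n → Set} cf a {p'} → All P cf → P p' → All P (setAt cf a p')
  setAt⁺ []       a       []         _  = []
  setAt⁺ (x ∷ cf) zero    (_ ∷ Pcf)  Pp = Pp ∷ Pcf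
  setAt⁺ (x ∷ cf) (suc a) (Px ∷ Pcf) Pp = Px ∷ setAt⁺ cf a Pcf Pp

  run-∷⁻ : ∀ cf m ms {tr} → run cf (m ∷ ms) ≡ just tr →
           Σ Config λ cf' → step cf m ≡ just cf' × Σ (List Config) λ tr' → run cf' ms ≡ just tr' × tr ≡ cf ∷ tr'
  run-∷⁻ cf m ms eq with step cf m
  ... | just cf' with run cf' ms in ran
  ...   | just tr' = cf' , refl , tr' , ran , sym (just-injective eq)

  step-traverse⁻ : ∀ cf a k {cf'} → step cf (traverse a k) ≡ just cf' →
                   Σ (Fin n) λ p → at cf a ≡ just p × Σ (Fin n) λ p' → across k p ≡ just p' × cf' ≡ setAt cf a p'
  step-traverse⁻ cf a k eq with at cf a
  ... | just p with across k p in crossed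
  ...   | just p' = p , refl , p' , crossed , sym (just-injective eq)

  arc : ℕ → ℕ → ℚ
  arc a zero    = 0ℚ
  arc a (suc m) = wN a + arc (suc a) m

  arcTo arcFrom : ℕ → ℚ
  arcTo x   = arc 0 x
  arcFrom x = arc x (n ∸ x)

  arc-+ : ∀ a m₁ m₂ → arc a (m₁ ℕ.+ m₂) ≡ arc a m₁ + arc (a ℕ.+ m₁) m₂
  arc-+ a zero     m₂ = trans (cong (λ a → arc a m₂) (sym (ℕP.+-identityʳ a))) (sym (ℚP.+-identityˡ _))
  arc-+ a (suc m₁) m₂ = begin
    wN a + arc (suc a) (m₁ ℕ.+ m₂)                    ≡⟨ cong (wN a +_) (arc-+ (suc a) m₁ m₂) ⟩
    wN a + (arc (suc a) m₁ + arc (suc a ℕ.+ m₁) m₂)   ≡⟨ sym (ℚP.+-assoc (wN a) _ _) ⟩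
    wN a + arc (suc a) m₁ + arc (suc a ℕ.+ m₁) m₂     ≡⟨ cong (λ b → wN a + arc (suc a) m₁ + arc b m₂) (sym (ℕP.+-suc a m₁)) ⟩
    wN a + arc (suc a) m₁ + arc (a ℕ.+ suc m₁) m₂     ∎
    where open ≡-Reasoning

  arcTo-suc : ∀ x → arcTo (suc x) ≡ arcTo x + wN x
  arcTo-suc x = begin
    arc 0 (suc x)           ≡⟨ cong (arc 0) (ℕP.+-comm 1 x) ⟩
    arc 0 (x ℕ.+ 1)         ≡⟨ arc-+ 0 x 1 ⟩
    arcTo x + (wN x + 0ℚ)   ≡⟨ cong (arcTo x +_) (ℚP.+-identityʳ (wN x)) ⟩
    arcTo x + wN x          ∎
    where open ≡-Reasoning

  arcFrom-suc : ∀ {x} → x ℕ.< n → arcFrom x ≡ wN x + arcFrom (suc x)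
  arcFrom-suc {x} x<n = cong (arc x) (ℕP.+-∸-assoc 1 x<n)

  arcFrom-n : arcFrom n ≡ 0ℚ
  arcFrom-n = cong (arc n) (ℕP.n∸n≡0 n)

  arcFrom-N : arcFrom N ≡ wN N
  arcFrom-N = trans (arcFrom-suc ℕP.≤-refl) (trans (cong (wN N +_) arcFrom-n) (ℚP.+-identityʳ (wN N)))

  arcTo+arcFrom : ∀ {x} → x ℕ.≤ n → arcTo x + arcFrom x ≡ arc 0 n
  arcTo+arcFrom {x} x≤n = trans (sym (arc-+ 0 x (n ∸ x))) (cong (arc 0) (ℕP.m+[n∸m]≡n x≤n))

  foldr-applyUpTo≡arc : ∀ {A : Set} (h : A → ℚ) (f : ℕ → A) a m → (∀ k → h (f k) ≡ wN (a ℕ.+ k)) →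
                        foldr (λ x r → h x + r) 0ℚ (applyUpTo f m) ≡ arc a m
  foldr-applyUpTo≡arc h f a zero    hf = refl
  foldr-applyUpTo≡arc h f a (suc m) hf = cong₂ _+_
    (trans (hf 0) (cong wN (ℕP.+-identityʳ a)))
    (foldr-applyUpTo≡arc h (f ∘ suc) (suc a) m (λ k → trans (hf (suc k)) (cong wN (ℕP.+-suc a k))))

  dLo≡arcTo : ∀ j → dLo j ≡ arcTo (toℕ j)
  dLo≡arcTo j = foldr-applyUpTo≡arc _ (λ k → k) 0 (toℕ j) (λ k → refl)

  dHi≡arcFrom : ∀ j → dHi j ≡ arcFrom (suc (toℕ j))
  dHi≡arcFrom j = foldr-applyUpTo≡arc _ (λ k → k) (suc (toℕ j)) (n ∸ suc (toℕ j)) (λ k → refl)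

  total≡arc : total ≡ arc 0 n
  total≡arc = foldr-applyUpTo≡arc _ (λ k → k) 0 n (λ k → refl)

  w≡wN : ∀ j → w j ≡ wN (toℕ j)
  w≡wN j = cong w (sym (V-toℕ j))

  wC≡dLo+dHi : ∀ j → wC j ≡ dLo j + dHi j
  wC≡dLo+dHi j = begin
    total - w j                                  ≡⟨ cong₂ _-_ (trans total≡arc (sym (arcTo+arcFrom (ℕP.<⇒≤ (toℕ<n j)))))
                                                              (w≡wN j) ⟩
    arcTo x + arcFrom x - wN x                   ≡⟨ cong (λ d → arcTo x + d - wN x) (arcFrom-suc (toℕ<n j)) ⟩
    arcTo x + (wN x + arcFrom (suc x)) - wN x    ≡⟨ solve 3 (λ a b c → a :+ (b :+ c) :- b := a :+ c) refl
                                                          (arcTo x) (wN x) (arcFrom (suc x)) ⟩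
    arcTo x + arcFrom (suc x)                    ≡⟨ sym (cong₂ _+_ (dLo≡arcTo j) (dHi≡arcFrom j)) ⟩
    dLo j + dHi j                                ∎
    where open ≡-Reasoning
          open +-*-Solver
          x : ℕ
          x = toℕ j

  -- Lower bound

  data Traversal : ℕ → ℕ → ℕ → Set where
    forward      : ∀ x → Traversal x (suc x) x
    backward     : ∀ x → Traversal (suc x) x x
    wrapForward  : Traversal N 0 N
    wrapBackward : Traversal 0 N N

  traversal : ∀ {k p p'} → across k p ≡ just p' → Traversal (toℕ p) (toℕ p') (toℕ k)
  traversal {k} {p} {p'} eq with across⁻ {k} {p} {p'} eq | toℕ-nextV k
  ... | inj₁ (refl , refl) | inj₁ next          rewrite next        = forward (toℕ k)
  ... | inj₁ (refl , refl) | inj₂ (last , next) rewrite last | next = wrapForward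
  ... | inj₂ (refl , refl) | inj₁ next          rewrite next        = backward (toℕ k)
  ... | inj₂ (refl , refl) | inj₂ (last , next) rewrite last | next = wrapBackward

  -- With the arcs v_0 … v_α and v_{n-β} … v_n explored, HomeDist α β x d says that v_x is explored
  -- and d is the length of the way home from v_x inside the explored arcs.
  data HomeDist (α β : ℕ) : ℕ → ℚ → Set where
    front : ∀ {x} → x ℕ.≤ α     → HomeDist α β x (arcTo x)
    back  : ∀ {x} → n ∸ β ℕ.≤ x → HomeDist α β x (arcFrom x)

  Explored : ℕ → ℕ → ℕ → Set
  Explored α β x = Σ ℚ (HomeDist α β x)

  homeDist-mono : ∀ {α β α' β' x d} → α ℕ.≤ α' → β ℕ.≤ β' → HomeDist α β x d → HomeDist α' β' x d
  homeDist-mono α≤α' _    (front x≤α)  = front (ℕP.≤-trans x≤α α≤α')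
  homeDist-mono _    β≤β' (back n∸β≤x) = back (ℕP.≤-trans (ℕP.∸-monoʳ-≤ n β≤β') n∸β≤x)

  explored-mono : ∀ {α β α' β' x} → α ℕ.≤ α' → β ℕ.≤ β' → Explored α β x → Explored α' β' x
  explored-mono α≤α' β≤β' (d , hd) = d , homeDist-mono α≤α' β≤β' hd

  Incomplete : ℕ → ℕ → Set
  Incomplete α β = 2 ℕ.+ (α ℕ.+ β) ℕ.≤ n

  incomplete⇒α<N : ∀ {α β} → Incomplete α β → α ℕ.< N
  incomplete⇒α<N {α} {β} inc = ℕP.≤-pred (ℕP.≤-trans (s≤s (s≤s (ℕP.m≤m+n α β))) inc)

  incomplete⇒β<n : ∀ {α β} → Incomplete α β → β ℕ.< n
  incomplete⇒β<n {α} {β} inc = ℕP.≤-trans (s≤s (ℕP.m≤n+m β α)) (ℕP.≤-pred (ℕP.m≤n⇒m≤1+n inc))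

  incomplete⇒unexplored : ∀ {α β} → Incomplete α β → ¬ Explored α β (suc α)
  incomplete⇒unexplored _ (_ , front α+1≤α) = ℕP.<-irrefl refl α+1≤α
  incomplete⇒unexplored {α} {β} inc (_ , back n∸β≤α+1) =
    ℕP.<⇒≱ (ℕP.m+n≤o⇒m≤o∸n (2 ℕ.+ α) (subst (ℕ._≤ n) (sym (ℕP.+-assoc 2 α β)) inc)) n∸β≤α+1

  unexploredEdge : ∀ {α β} → suc (α ℕ.+ β) ≡ n → Σ (Fin n) λ j → dLo j ≡ arcTo α × dHi j ≡ arcFrom (n ∸ β)
  unexploredEdge {α} {β} complete =
    j , trans (dLo≡arcTo j) (cong arcTo toℕj≡α)
      , trans (dHi≡arcFrom j) (cong arcFrom (trans (cong suc toℕj≡α) (sym n∸β≡1+α)))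
    where
      α<n : α ℕ.< n
      α<n = ℕP.≤-trans (s≤s (ℕP.m≤m+n α β)) (ℕP.≤-reflexive complete)
      j : Fin n
      j = fromℕ< α<n
      toℕj≡α : toℕ j ≡ α
      toℕj≡α = toℕ-fromℕ< α<n
      n∸β≡1+α : n ∸ β ≡ suc α
      n∸β≡1+α = trans (cong (_∸ β) (sym complete)) (ℕP.m+n∸n≡m (suc α) β)

  Φ : ℕ → ℕ → ℚ
  Φ α β = arcTo α + arcFrom (n ∸ β)

  Ψ : ℕ → ℕ → ℚ → ℚ
  Ψ α β d = Φ α β + Φ α β - d

  Φ-sucˡ : ∀ α β → Φ (suc α) β ≡ Φ α β + wN α
  Φ-sucˡ α β = trans (cong (_+ arcFrom (n ∸ β)) (arcTo-suc α))
                     (solve 3 (λ a b c → a :+ b :+ c := a :+ c :+ b) refl (arcTo α) (wN α) (arcFrom (n ∸ β)))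
    where open +-*-Solver

  Φ-sucʳ : ∀ α {β} → β ℕ.< n → Φ α (suc β) ≡ Φ α β + wN (n ∸ suc β)
  Φ-sucʳ α {β} (s≤s β≤N) = begin
    arcTo α + arcFrom (N ∸ β)                        ≡⟨ cong (arcTo α +_) (arcFrom-suc (s≤s (ℕP.m∸n≤m N β))) ⟩
    arcTo α + (wN (N ∸ β) + arcFrom (suc (N ∸ β)))   ≡⟨ cong (λ x → arcTo α + (wN (N ∸ β) + arcFrom x))
                                                             (sym (ℕP.+-∸-assoc 1 β≤N)) ⟩
    arcTo α + (wN (N ∸ β) + arcFrom (n ∸ β))         ≡⟨ solve 3 (λ a b c → a :+ (b :+ c) := a :+ c :+ b) refl
                                                             (arcTo α) (wN (N ∸ β)) (arcFrom (n ∸ β)) ⟩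
    Φ α β + wN (N ∸ β)                               ∎
    where open ≡-Reasoning
          open +-*-Solver

  record Progress (α β : ℕ) (d : ℚ) (x' : ℕ) (wk : ℚ) : Set where
    field
      {α' β'}  : ℕ
      {d'}     : ℚ
      α≤α'     : α ℕ.≤ α'
      β≤β'     : β ℕ.≤ β'
      bounded  : suc (α' ℕ.+ β') ℕ.≤ n
      homeDist : HomeDist α' β' x' d'
      Φ-step   : Φ α' β' ≤ℚ Φ α β + wk
      Ψ-step   : Ψ α' β' d' ≤ℚ Ψ α β d + wk

  extend : ∀ {α β α' β' x' d wk} → α ℕ.≤ α' → β ℕ.≤ β' → suc (α' ℕ.+ β') ℕ.≤ n →
           HomeDist α' β' x' (d + wk) → Φ α' β' ≡ Φ α β + wk → Progress α β d x' wk
  extend {α} {β} {α'} {β'} {d = d} {wk} α≤α' β≤β' bounded hd Φ-grows = record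
    { α≤α' = α≤α' ; β≤β' = β≤β' ; bounded = bounded ; homeDist = hd
    ; Φ-step = ℚP.≤-reflexive Φ-grows
    ; Ψ-step = ℚP.≤-reflexive (begin
        Φ α' β' + Φ α' β' - (d + wk)               ≡⟨ cong (λ f → f + f - (d + wk)) Φ-grows ⟩
        Φ α β + wk + (Φ α β + wk) - (d + wk)       ≡⟨ solve 3 (λ f d wk → f :+ wk :+ (f :+ wk) :- (d :+ wk) := f :+ f :- d :+ wk)
                                                            refl (Φ α β) d wk ⟩
        Ψ α β d + wk                               ∎) }
    where open ≡-Reasoning
          open +-*-Solver

  extendTo : ∀ {α β x' d} → Incomplete α β → HomeDist (suc α) β x' (d + wN α) → Progress α β d x' (wN α)
  extendTo {α} {β} inc hd = extend (ℕP.n≤1+n α) ℕP.≤-refl inc hd (Φ-sucˡ α β)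

  extendFrom : ∀ {α β x' d} → Incomplete α β → HomeDist α (suc β) x' (d + wN (n ∸ suc β)) →
               Progress α β d x' (wN (n ∸ suc β))
  extendFrom {α} {β} inc hd =
    extend ℕP.≤-refl (ℕP.n≤1+n β) (subst (λ m → suc m ℕ.≤ n) (sym (ℕP.+-suc α β)) inc) hd
           (Φ-sucʳ α (incomplete⇒β<n {α} {β} inc))

  cMin≤ : ℚ → Set
  cMin≤ x = Σ (Fin n) λ j → c j ≤ℚ x

  cMin≤-mono : ∀ {x y} → cMin≤ x → x ≤ℚ y → cMin≤ y
  cMin≤-mono (j , cj≤x) x≤y = j , ℚP.≤-trans cj≤x x≤y

  Potential : ℕ → ℕ → Config → ℚ → Set
  Potential α β []          acc = α ≡ 0 × β ≡ 0 × 0ℚ ≤ℚ acc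
  Potential α β (p ∷ [])    acc = Σ ℚ λ d → HomeDist α β (toℕ p) d × q + Ψ α β d ≤ℚ acc
  Potential α β (_ ∷ _ ∷ _) acc = q + q + Φ α β ≤ℚ acc

  record Invariant (cf : Config) (α β : ℕ) (acc : ℚ) : Set where
    field
      incomplete     : Incomplete α β
      agentsExplored : All (λ p → Explored α β (toℕ p)) cf
      potential      : Potential α β cf acc

  data Next (cf : Config) (α β : ℕ) (acc : ℚ) : Set where
    finished  : cMin≤ acc → Next cf α β acc
    continued : ∀ {α' β'} → α ℕ.≤ α' → β ℕ.≤ β' → Invariant cf α' β' acc → Next cf α β acc

  Covered : ℕ → ℕ → List Config → Set
  Covered α β tr = ∀ v → Explored α β (toℕ v) ⊎ Any (v ∈_) tr

  covered-tail : ∀ {cf α β α' β' tr} → α ℕ.≤ α' → β ℕ.≤ β' → All (λ p → Explored α β (toℕ p)) cf →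
                 Covered α β (cf ∷ tr) → Covered α' β' tr
  covered-tail α≤α' β≤β' agentsExplored covered v with covered v
  ... | inj₁ explored     = inj₁ (explored-mono α≤α' β≤β' explored)
  ... | inj₂ (here v∈cf)  = inj₁ (explored-mono α≤α' β≤β' (All.lookup agentsExplored v∈cf))
  ... | inj₂ (there v∈tr) = inj₂ v∈tr

  incomplete⇒uncovered : ∀ {cf α β acc} → Invariant cf α β acc → ¬ Covered α β (cf ∷ [])
  incomplete⇒uncovered {cf} {α} {β} inv covered =
    [ unexplored , (λ { (here u∈cf) → unexplored (All.lookup agentsExplored u∈cf) ; (there ()) }) ]′
      (covered (fromℕ< α+1<n))
    where
      open Invariant inv
      α+1<n : suc α ℕ.< n
      α+1<n = ℕP.≤-trans (s≤s (s≤s (ℕP.m≤m+n α β))) incomplete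
      unexplored : ¬ Explored α β (toℕ (fromℕ< α+1<n))
      unexplored = incomplete⇒unexplored incomplete ∘ subst (Explored α β) (toℕ-fromℕ< α+1<n)

  continueOrFinish : ∀ {cf α β α' β' acc} → α ℕ.≤ α' → β ℕ.≤ β' → suc (α' ℕ.+ β') ℕ.≤ n →
                     (Incomplete α' β' → Invariant cf α' β' acc) → (suc (α' ℕ.+ β') ≡ n → cMin≤ acc) →
                     Next cf α β acc
  continueOrFinish {α' = α'} {β'} α≤α' β≤β' bounded invariant finish with 2 ℕ.+ (α' ℕ.+ β') ℕ.≤? n
  ... | yes inc = continued α≤α' β≤β' (invariant inc)
  ... | no ¬inc = finished (finish (ℕP.≤-antisym bounded (ℕP.≤-pred (ℕP.≰⇒> ¬inc))))

  module _ (w≥0 : ∀ k → 0ℚ ≤ℚ w k) where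

    wN≥0 : ∀ x → 0ℚ ≤ℚ wN x
    wN≥0 x = w≥0 (V x)

    arc≥0 : ∀ a m → 0ℚ ≤ℚ arc a m
    arc≥0 a zero    = ℚP.≤-refl
    arc≥0 a (suc m) = ℚP.≤-trans (arc≥0 (suc a) m) (x≤y+x _ (wN≥0 a))

    arcTo-mono : ∀ {x y} → x ℕ.≤ y → arcTo x ≤ℚ arcTo y
    arcTo-mono {x} {y} x≤y = ℚP.≤-trans (x≤x+y (arcTo x) (arc≥0 x (y ∸ x)))
      (ℚP.≤-reflexive (trans (sym (arc-+ 0 x (y ∸ x))) (cong (arc 0) (ℕP.m+[n∸m]≡n x≤y))))

    arcFrom-anti : ∀ {x y} → x ℕ.≤ y → y ℕ.≤ n → arcFrom y ≤ℚ arcFrom x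
    arcFrom-anti {x} {y} x≤y y≤n = ℚP.≤-trans (x≤y+x (arcFrom y) (arc≥0 x (y ∸ x)))
      (ℚP.≤-reflexive (begin
        arc x (y ∸ x) + arc y (n ∸ y)                ≡⟨ cong (λ z → arc x (y ∸ x) + arc z (n ∸ y))
                                                                 (sym (ℕP.m+[n∸m]≡n x≤y)) ⟩
        arc x (y ∸ x) + arc (x ℕ.+ (y ∸ x)) (n ∸ y)  ≡⟨ sym (arc-+ x (y ∸ x) (n ∸ y)) ⟩
        arc x ((y ∸ x) ℕ.+ (n ∸ y))                  ≡⟨ cong (arc x) lengths ⟩
        arcFrom x                                    ∎))
      where
        open ≡-Reasoning
        lengths : (y ∸ x) ℕ.+ (n ∸ y) ≡ n ∸ x
        lengths = trans (ℕP.+-comm (y ∸ x) (n ∸ y))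
                        (trans (sym (ℕP.+-∸-assoc (n ∸ y) x≤y)) (cong (_∸ x) (ℕP.m∸n+n≡m y≤n)))

    homeDist≤ : ∀ {α β x d} → x ℕ.< n → HomeDist α β x d → d ≤ℚ arcTo α ⊎ d ≤ℚ arcFrom (n ∸ β)
    homeDist≤ _   (front x≤α)  = inj₁ (arcTo-mono x≤α)
    homeDist≤ x<n (back n∸β≤x) = inj₂ (arcFrom-anti n∸β≤x (ℕP.<⇒≤ x<n))

    homeDist≤Φ : ∀ {α β x d} → x ℕ.< n → HomeDist α β x d → d ≤ℚ Φ α β
    homeDist≤Φ {α} {β} x<n hd with homeDist≤ x<n hd
    ... | inj₁ d≤ = ℚP.≤-trans d≤ (x≤x+y (arcTo α) (arc≥0 (n ∸ β) (n ∸ (n ∸ β))))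
    ... | inj₂ d≤ = ℚP.≤-trans d≤ (x≤y+x (arcFrom (n ∸ β)) (arc≥0 0 α))

    stay : ∀ {α β x' d d' wk} → Incomplete α β → HomeDist α β x' d' → 0ℚ ≤ℚ wk → d ≤ℚ wk + d' →
           Progress α β d x' wk
    stay {α} {β} {d = d} {d'} {wk} inc hd 0≤wk d≤wk+d' = record
      { α≤α' = ℕP.≤-refl ; β≤β' = ℕP.≤-refl ; bounded = ℕP.≤-trans (ℕP.n≤1+n _) inc ; homeDist = hd
      ; Φ-step = x≤x+y (Φ α β) 0≤wk
      ; Ψ-step = begin
          Φ α β + Φ α β - d'               ≡⟨ solve 3 (λ f d' wk → f :- d' := f :- (wk :+ d') :+ wk) refl
                                                      (Φ α β + Φ α β) d' wk ⟩
          Φ α β + Φ α β - (wk + d') + wk   ≤⟨ ℚP.+-monoˡ-≤ wk (ℚP.+-monoʳ-≤ (Φ α β + Φ α β)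
                                                                         (ℚP.neg-antimono-≤ d≤wk+d')) ⟩
          Φ α β + Φ α β - d + wk           ∎ }
      where open ℚP.≤-Reasoning
            open +-*-Solver

    progress-forward : ∀ {α β x d} → Incomplete α β → suc x ℕ.< n → HomeDist α β x d →
                       Progress α β d (suc x) (wN x)
    progress-forward {β = β} {x} inc _ (front x≤α) with ℕP.m≤n⇒m<n∨m≡n x≤α
    ... | inj₁ x<α  = stay inc (front x<α) (wN≥0 x) (ℚP.≤-trans (arcTo-mono (ℕP.n≤1+n x)) (x≤y+x _ (wN≥0 x)))
    ... | inj₂ refl = extendTo inc (subst (HomeDist (suc x) β (suc x)) (arcTo-suc x) (front ℕP.≤-refl))
    progress-forward {x = x} inc x+1<n (back n∸β≤x) =
      stay inc (back (ℕP.m≤n⇒m≤1+n n∸β≤x)) (wN≥0 x) (ℚP.≤-reflexive (arcFrom-suc (ℕP.<-trans (ℕP.n<1+n x) x+1<n)))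

    progress-backward : ∀ {α β x d} → Incomplete α β → suc x ℕ.< n → HomeDist α β (suc x) d →
                        Progress α β d x (wN x)
    progress-backward {x = x} inc _ (front x+1≤α) =
      stay inc (front (ℕP.≤-trans (ℕP.n≤1+n x) x+1≤α)) (wN≥0 x)
        (ℚP.≤-reflexive (trans (arcTo-suc x) (ℚP.+-comm (arcTo x) (wN x))))
    progress-backward {α} {β} {x} inc x+1<n (back n∸β≤x+1) with n ∸ β ℕ.≤? x
    ... | yes n∸β≤x = stay inc (back n∸β≤x) (wN≥0 x)
                        (ℚP.≤-trans (arcFrom-anti (ℕP.n≤1+n x) (ℕP.<⇒≤ x+1<n)) (x≤y+x _ (wN≥0 x)))
    ... | no n∸β≰x  = subst (λ y → Progress α β (arcFrom (suc x)) x (wN y)) n∸1+β≡x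
                        (extendFrom inc (subst (HomeDist α (suc β) x) (sym arcFrom-x) (back (ℕP.≤-reflexive n∸1+β≡x))))
      where
        n∸1+β≡x : n ∸ suc β ≡ x
        n∸1+β≡x = trans (sym (ℕP.pred[m∸n]≡m∸[1+n] n β)) (cong ℕ.pred (ℕP.≤-antisym n∸β≤x+1 (ℕP.≰⇒> n∸β≰x)))
        arcFrom-x : arcFrom (suc x) + wN (n ∸ suc β) ≡ arcFrom x
        arcFrom-x = trans (cong (λ y → arcFrom (suc x) + wN y) n∸1+β≡x)
          (trans (ℚP.+-comm (arcFrom (suc x)) (wN x)) (sym (arcFrom-suc (ℕP.<-trans (ℕP.n<1+n x) x+1<n))))

    progress-wrapForward : ∀ {α β d} → Incomplete α β → HomeDist α β N d → Progress α β d 0 (wN N)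
    progress-wrapForward {α} {β} inc (front N≤α) = ⊥-elim (ℕP.<⇒≱ (incomplete⇒α<N {α} {β} inc) N≤α)
    progress-wrapForward inc (back _) =
      stay inc (front z≤n) (wN≥0 N) (ℚP.≤-reflexive (trans arcFrom-N (sym (ℚP.+-identityʳ (wN N)))))

    progress-wrapBackward : ∀ {α β d} → Incomplete α β → HomeDist α β 0 d → Progress α β d N (wN N)
    progress-wrapBackward {α} {β} inc (back n∸β≤0) =
      ⊥-elim (ℕP.<⇒≱ (ℕP.m<n⇒0<n∸m (incomplete⇒β<n {α} {β} inc)) n∸β≤0)
    progress-wrapBackward {α} {zero} inc (front _) =
      extendFrom inc (subst (HomeDist α 1 N) (trans arcFrom-N (sym (ℚP.+-identityˡ (wN N)))) (back ℕP.≤-refl))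
    progress-wrapBackward {β = suc β} inc (front _) =
      stay inc (back (ℕP.m∸n≤m N β)) (wN≥0 N) (ℚP.≤-trans (arc≥0 N (n ∸ N)) (x≤y+x _ (wN≥0 N)))

    progress : ∀ {α β d k p p'} → Incomplete α β → HomeDist α β (toℕ p) d → across k p ≡ just p' →
               Progress α β d (toℕ p') (w k)
    progress {α} {β} {d} {k} {p} {p'} inc hd crossed =
      subst (Progress α β d (toℕ p')) (sym (w≡wN k)) (by-traversal (toℕ<n p) (toℕ<n p') hd (traversal crossed))
      where
        by-traversal : ∀ {x x' k d} → x ℕ.< n → x' ℕ.< n → HomeDist α β x d → Traversal x x' k →
                       Progress α β d x' (wN k)
        by-traversal _   x'<n hd (forward _)  = progress-forward inc x'<n hd
        by-traversal x<n _    hd (backward _) = progress-backward inc x<n hd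
        by-traversal _   _    hd wrapForward  = progress-wrapForward inc hd
        by-traversal _   _    hd wrapBackward = progress-wrapBackward inc hd

    c≤q+dmin+wC : ∀ j → c j ≤ℚ q + (dLo j ⊓ dHi j) + wC j
    c≤q+dmin+wC j with isEnd j
    ... | true  = ℚP.+-monoˡ-≤ (wC j) (x≤x+y q (ℚP.⊓-glb dLo≥0 dHi≥0))
      where dLo≥0 : 0ℚ ≤ℚ dLo j
            dLo≥0 = subst (0ℚ ≤ℚ_) (sym (dLo≡arcTo j)) (arc≥0 0 (toℕ j))
            dHi≥0 : 0ℚ ≤ℚ dHi j
            dHi≥0 = subst (0ℚ ≤ℚ_) (sym (dHi≡arcFrom j)) (arc≥0 (suc (toℕ j)) (n ∸ suc (toℕ j)))
    ... | false = ℚP.p⊓q≤q (q + q + wC j) (q + (dLo j ⊓ dHi j) + wC j)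

    module _ (q≥0 : 0ℚ ≤ℚ q) where

      c≤2q+wC : ∀ j → c j ≤ℚ q + q + wC j
      c≤2q+wC j with isEnd j
      ... | true  = ℚP.+-monoˡ-≤ (wC j) (x≤x+y q q≥0)
      ... | false = ℚP.p⊓q≤p (q + q + wC j) (q + (dLo j ⊓ dHi j) + wC j)

      cost≥0 : ∀ ms → 0ℚ ≤ℚ cost ms
      cost≥0 []                  = ℚP.≤-refl
      cost≥0 (invoke ∷ ms)       = ℚP.≤-trans (cost≥0 ms) (x≤y+x _ q≥0)
      cost≥0 (traverse _ k ∷ ms) = ℚP.≤-trans (cost≥0 ms) (x≤y+x _ (w≥0 k))

      finished-multi : ∀ {α β acc} → suc (α ℕ.+ β) ≡ n → q + q + Φ α β ≤ℚ acc → cMin≤ acc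
      finished-multi {α} {β} complete bound with unexploredEdge {α} {β} complete
      ... | j , dLo≡ , dHi≡ = j , ℚP.≤-trans (c≤2q+wC j)
        (ℚP.≤-trans (ℚP.≤-reflexive (cong (q + q +_) (trans (wC≡dLo+dHi j) (cong₂ _+_ dLo≡ dHi≡)))) bound)

      finished-single : ∀ {α β d acc} → suc (α ℕ.+ β) ≡ n → d ≤ℚ arcTo α ⊎ d ≤ℚ arcFrom (n ∸ β) →
                        q + Ψ α β d ≤ℚ acc → cMin≤ acc
      finished-single {α} {β} {d} {acc} complete d≤ bound with unexploredEdge {α} {β} complete
      ... | j , dLo≡ , dHi≡ = j , (begin
        c j                           ≤⟨ c≤q+dmin+wC j ⟩
        q + (dLo j ⊓ dHi j) + wC j    ≡⟨ cong₂ (λ m s → q + m + s) (cong₂ _⊓_ dLo≡ dHi≡)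
                                                (trans (wC≡dLo+dHi j) (cong₂ _+_ dLo≡ dHi≡)) ⟩
        q + (a ⊓ b) + (a + b)         ≡⟨ ℚP.+-assoc q (a ⊓ b) (a + b) ⟩
        q + ((a ⊓ b) + (a + b))       ≤⟨ ℚP.+-monoʳ-≤ q (min+sum≤Ψ d≤) ⟩
        q + Ψ α β d                   ≤⟨ bound ⟩
        acc                           ∎)
        where
          open ℚP.≤-Reasoning
          a b : ℚ
          a = arcTo α
          b = arcFrom (n ∸ β)
          min+sum≤Ψ : d ≤ℚ a ⊎ d ≤ℚ b → (a ⊓ b) + (a + b) ≤ℚ Ψ α β d
          min+sum≤Ψ (inj₁ d≤a) = m+[a+b]≤[a+b]+[a+b]-d (ℚP.p⊓q≤q a b) d≤a
          min+sum≤Ψ (inj₂ d≤b) = begin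
            (a ⊓ b) + (a + b)       ≡⟨ cong ((a ⊓ b) +_) (ℚP.+-comm a b) ⟩
            (a ⊓ b) + (b + a)       ≤⟨ m+[a+b]≤[a+b]+[a+b]-d (ℚP.p⊓q≤p a b) d≤b ⟩
            (b + a) + (b + a) - d   ≡⟨ cong (λ s → s + s - d) (ℚP.+-comm b a) ⟩
            Ψ α β d                 ∎

      initial : Invariant [] 0 0 0ℚ
      initial = record { incomplete = s≤s (s≤s z≤n) ; agentsExplored = [] ; potential = refl , refl , ℚP.≤-refl }

      invoke-invariant : ∀ {cf α β acc} → Invariant cf α β acc → Invariant (cf ++ V 0 ∷ []) α β (acc + q)
      invoke-invariant {cf} {α} {β} {acc} inv = record
        { incomplete     = incomplete
        ; agentsExplored = AllP.++⁺ agentsExplored ((0ℚ , front z≤n) ∷ [])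
        ; potential      = invoke-potential cf potential }
        where
          open Invariant inv
          invoke-potential : ∀ cf → Potential α β cf acc → Potential α β (cf ++ V 0 ∷ []) (acc + q)
          invoke-potential [] (refl , refl , 0≤acc) =
            0ℚ , front z≤n , ℚP.≤-trans (ℚP.≤-reflexive first-potential) (x≤y+x q 0≤acc)
            where
              first-potential : q + Ψ 0 0 0ℚ ≡ q
              first-potential = trans (cong (λ f → q + (0ℚ + f + (0ℚ + f) - 0ℚ)) arcFrom-n) (ℚP.+-identityʳ q)
          invoke-potential (p ∷ []) (d , hd , bound) = begin
            q + q + Φ α β                   ≡⟨ solve 2 (λ q f → q :+ q :+ f := q :+ (f :+ con 0ℚ) :+ q) refl q (Φ α β) ⟩
            q + (Φ α β + 0ℚ) + q            ≤⟨ ℚP.+-monoˡ-≤ q (ℚP.+-monoʳ-≤ q (ℚP.+-monoʳ-≤ (Φ α β) 0≤Φ-d)) ⟩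
            q + (Φ α β + (Φ α β - d)) + q   ≡⟨ cong (λ f → q + f + q) (sym (ℚP.+-assoc (Φ α β) (Φ α β) (- d))) ⟩
            q + Ψ α β d + q                 ≤⟨ ℚP.+-monoˡ-≤ q bound ⟩
            acc + q                         ∎
            where
              open ℚP.≤-Reasoning
              open +-*-Solver
              0≤Φ-d : 0ℚ ≤ℚ Φ α β - d
              0≤Φ-d = ℚP.≤-trans (ℚP.≤-reflexive (sym (ℚP.+-inverseʳ d)))
                                 (ℚP.+-monoˡ-≤ (- d) (homeDist≤Φ (toℕ<n p) hd))
          invoke-potential (_ ∷ _ ∷ _) bound = ℚP.≤-trans bound (x≤x+y acc q≥0)

      traverse-next : ∀ {cf α β acc a k p p'} → Invariant cf α β acc → at cf a ≡ just p → across k p ≡ just p' →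
                      Next (setAt cf a p') α β (acc + w k)
      traverse-next {p ∷ []} {acc = acc} {zero} {k} {p' = p'} inv refl crossed with Invariant.potential inv
      ... | d , hd , bound = continueOrFinish α≤α' β≤β' bounded
        (λ inc → record { incomplete = inc ; agentsExplored = (d' , homeDist) ∷ [] ; potential = d' , homeDist , bound' })
        (λ complete → finished-single {α'} {β'} complete (homeDist≤ (toℕ<n p') homeDist) bound')
        where
          open Progress (progress (Invariant.incomplete inv) hd crossed)
          bound' : q + Ψ α' β' d' ≤ℚ acc + w k
          bound' = x+y≤z⇒x+y'≤z+w q bound Ψ-step
      traverse-next {_ ∷ []} {a = suc _} inv () crossed
      traverse-next {cf@(_ ∷ _ ∷ _)} {α} {β} {acc} {a} {k} {p' = p'} inv located crossed =
        continueOrFinish α≤α' β≤β' bounded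
          (λ inc → record
            { incomplete     = inc
            ; agentsExplored = setAt⁺ cf a (All.map (explored-mono α≤α' β≤β') agentsExplored) (d' , homeDist)
            ; potential      = potential-setAt a })
          (λ complete → finished-multi {α'} {β'} complete bound')
        where
          open Invariant inv
          open Progress (progress incomplete (proj₂ (All.lookup agentsExplored (at-∈ cf {a} located))) crossed)
          bound' : q + q + Φ α' β' ≤ℚ acc + w k
          bound' = x+y≤z⇒x+y'≤z+w (q + q) potential Φ-step
          potential-setAt : ∀ a → Potential α' β' (setAt cf a p') (acc + w k)
          potential-setAt zero          = bound'
          potential-setAt (suc zero)    = bound'
          potential-setAt (suc (suc a)) = bound'

      lowerBound : ∀ ms {cf α β acc tr} → Invariant cf α β acc → run cf ms ≡ just tr → Covered α β tr →
                   cMin≤ (acc + cost ms)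
      lowerBound [] inv refl covered = ⊥-elim (incomplete⇒uncovered inv covered)
      lowerBound (m ∷ ms) {cf} inv ran covered with run-∷⁻ cf m ms ran
      lowerBound (invoke ∷ ms) {acc = acc} inv _ covered | _ , refl , _ , ran' , refl =
        cMin≤-mono (lowerBound ms (invoke-invariant inv) ran' (covered-tail ℕP.≤-refl ℕP.≤-refl agentsExplored covered))
                   (ℚP.≤-reflexive (ℚP.+-assoc acc q (cost ms)))
        where open Invariant inv
      lowerBound (traverse a k ∷ ms) {cf} {acc = acc} inv _ covered | _ , stepped , _ , ran' , refl
        with step-traverse⁻ cf a k stepped
      ... | _ , located , _ , crossed , refl with traverse-next inv located crossed
      ...   | finished bound = cMin≤-mono bound (ℚP.+-monoʳ-≤ acc (x≤x+y (w k) (cost≥0 ms)))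
      ...   | continued α≤α' β≤β' inv' =
        cMin≤-mono (lowerBound ms inv' ran' (covered-tail α≤α' β≤β' (Invariant.agentsExplored inv) covered))
                   (ℚP.≤-reflexive (ℚP.+-assoc acc (w k) (cost ms)))

      explores⇒cMin≤ : ∀ {s} → Explores s → cMin≤ (cost s)
      explores⇒cMin≤ {s} (tr , ran , visited) =
        cMin≤-mono (lowerBound s initial ran (λ v → inj₂ (visited v))) (ℚP.≤-reflexive (ℚP.+-identityˡ (cost s)))

  -- Upper bound

  data Path : Fin n → List (Fin n) → Fin n → Set where
    []  : ∀ {p} → Path p [] p
    _∷_ : ∀ {k p p' p'' es} → across k p ≡ just p' → Path p' es p'' → Path p (k ∷ es) p''

  OnPath : ∀ {p es p'} → Path p es p' → Fin n → Set
  OnPath {p} []      v = v ≡ p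
  OnPath {p} (_ ∷ π) v = v ≡ p ⊎ OnPath π v

  _++ᵖ_ : ∀ {p es p' fs p''} → Path p es p' → Path p' fs p'' → Path p (es ++ fs) p''
  []      ++ᵖ ρ = ρ
  (e ∷ π) ++ᵖ ρ = e ∷ (π ++ᵖ ρ)

  reverseᵖ : ∀ {p es p'} → Path p es p' → Path p' (reverse es) p
  reverseᵖ []                 = []
  reverseᵖ (_∷_ {k} {p} {es = es} e π) =
    subst (λ ks → Path _ ks p) (sym (LP.unfold-reverse k es)) (reverseᵖ π ++ᵖ (across-sym e ∷ []))

  onPath-start : ∀ {p es p'} (π : Path p es p') → OnPath π p
  onPath-start []      = refl
  onPath-start (_ ∷ _) = inj₁ refl

  onPath-++ˡ : ∀ {p es p' fs p'' v} (π : Path p es p') (ρ : Path p' fs p'') → OnPath π v → OnPath (π ++ᵖ ρ) v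
  onPath-++ˡ []      ρ refl         = onPath-start ρ
  onPath-++ˡ (e ∷ π) ρ (inj₁ v≡p)  = inj₁ v≡p
  onPath-++ˡ (e ∷ π) ρ (inj₂ onπ)  = inj₂ (onPath-++ˡ π ρ onπ)

  onPath-++ʳ : ∀ {p es p' fs p'' v} (π : Path p es p') (ρ : Path p' fs p'') → OnPath ρ v → OnPath (π ++ᵖ ρ) v
  onPath-++ʳ []      ρ onρ = onρ
  onPath-++ʳ (e ∷ π) ρ onρ = inj₂ (onPath-++ʳ π ρ onρ)

  onPath-subst : ∀ {p es es' p' v} (eq : es ≡ es') (π : Path p es p') → OnPath π v →
                 OnPath (subst (λ ks → Path p ks p') eq π) v
  onPath-subst refl π onπ = onπ

  sequencePath : ∀ (g h : ℕ → Fin n) t → (∀ i → i ℕ.< t → across (h i) (g i) ≡ just (g (suc i))) →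
                 Path (g 0) (applyUpTo h t) (g t)
  sequencePath g h zero    crosses = []
  sequencePath g h (suc t) crosses =
    crosses 0 (s≤s z≤n) ∷ sequencePath (g ∘ suc) (h ∘ suc) t (λ i i<t → crosses (suc i) (s≤s i<t))

  onPath-sequence : ∀ g h t crosses {i} → i ℕ.≤ t → OnPath (sequencePath g h t crosses) (g i)
  onPath-sequence g h zero    crosses {zero}  _         = refl
  onPath-sequence g h (suc t) crosses {zero}  _         = inj₁ refl
  onPath-sequence g h (suc t) crosses {suc i} (s≤s i≤t) =
    inj₂ (onPath-sequence (g ∘ suc) (h ∘ suc) t (λ i i<t → crosses (suc i) (s≤s i<t)) i≤t)

  record Visits (cf : Config) (ms : List Move) (P : Fin n → Set) : Set where
    field
      trace   : List Config
      runs    : run cf ms ≡ just (cf ∷ trace)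
      visited : ∀ v → P v → Any (v ∈_) (cf ∷ trace)

  visits-[] : ∀ cf → Visits cf [] (_∈ cf)
  visits-[] cf = record { trace = [] ; runs = refl ; visited = λ v → here }

  visits-weaken : ∀ {cf ms P Q} → (∀ v → Q v → P v) → Visits cf ms P → Visits cf ms Q
  visits-weaken Q⇒P vis = record { Visits vis ; visited = λ v → Visits.visited vis v ∘ Q⇒P v }

  visits-invoke : ∀ {cf ms P} → Visits (cf ++ V 0 ∷ []) ms P → Visits cf (invoke ∷ ms) P
  visits-invoke {cf} {ms} vis = record
    { trace   = (cf ++ V 0 ∷ []) ∷ trace
    ; runs    = cong (λ r → r >>= λ tr → just (cf ∷ tr)) runs
    ; visited = λ v → there ∘ visited v }
    where open Visits vis

  visits-here : ∀ {cf ms P} → Visits cf ms P → Visits cf ms (λ v → P v ⊎ v ∈ cf)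
  visits-here vis = record { Visits vis ; visited = λ { v (inj₁ Pv)   → Visits.visited vis v Pv
                                                      ; v (inj₂ v∈cf) → here v∈cf } }

  visits-traverse : ∀ {cf ms P a k p p'} → at cf a ≡ just p → across k p ≡ just p' →
                    Visits (setAt cf a p') ms P → Visits cf (traverse a k ∷ ms) P
  visits-traverse {cf} {ms} {a = a} {k} {p} {p'} located crossed vis = record
    { trace = setAt cf a p' ∷ trace ; runs = ran ; visited = λ v → there ∘ visited v }
    where
      open Visits vis
      ran : run cf (traverse a k ∷ ms) ≡ just (cf ∷ setAt cf a p' ∷ trace)
      ran rewrite located | crossed | runs = refl

  visits-walk : ∀ {cf ms P a p es p'} → at cf a ≡ just p → (π : Path p es p') → Visits (setAt cf a p') ms P →
                Visits cf (walk a es ++ ms) (λ v → P v ⊎ OnPath π v)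
  visits-walk {cf} {ms} {P} located [] vis =
    visits-weaken (λ { v (inj₁ Pv) → inj₁ Pv ; v (inj₂ refl) → inj₂ (at-∈ cf located) })
      (visits-here (subst (λ cf → Visits cf ms P) (setAt-at cf located) vis))
  visits-walk {cf} {ms} {P} {a} located (_∷_ {p' = p₁} crossed π) vis =
    visits-weaken (λ { v (inj₁ Pv)          → inj₁ (inj₁ Pv)
                     ; v (inj₂ (inj₁ refl)) → inj₂ (at-∈ cf located)
                     ; v (inj₂ (inj₂ onπ))  → inj₁ (inj₂ onπ) })
      (visits-here (visits-traverse located crossed
        (visits-walk (at-setAt cf p₁ located) π (subst (λ cf → Visits cf ms P) (sym (setAt-setAt cf a p₁ _)) vis))))

  visits⇒explores : ∀ {ms P} → Visits [] ms P → (∀ v → P v) → Explores ms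
  visits⇒explores vis all = [] ∷ trace , runs , λ v → visited v (all v)
    where open Visits vis

  singleAgent : List (Fin n) → List Move
  singleAgent es = invoke ∷ walk 0 es

  twoAgents : List (Fin n) → List (Fin n) → List Move
  twoAgents es fs = invoke ∷ walk 0 es ++ (invoke ∷ walk 1 fs)

  outAndBack : List (Fin n) → List (Fin n) → List Move
  outAndBack es fs = invoke ∷ walk 0 (es ++ reverse es ++ fs)

  visits-walk-end : ∀ {cf a p es p'} → at cf a ≡ just p → (π : Path p es p') → Visits cf (walk a es) (OnPath π)
  visits-walk-end {cf} {a} {es = es} {p'} located π = visits-weaken (λ _ → inj₂)
    (subst (λ ms → Visits cf ms (λ v → v ∈ setAt cf a p' ⊎ OnPath π v)) (LP.++-identityʳ (walk a es))
      (visits-walk located π (visits-[] (setAt cf a p'))))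

  explores-singleAgent : ∀ {es p'} (π : Path (V 0) es p') → (∀ v → OnPath π v) → Explores (singleAgent es)
  explores-singleAgent π onπ = visits⇒explores (visits-invoke (visits-walk-end refl π)) onπ

  explores-twoAgents : ∀ {es fs p' r'} (π : Path (V 0) es p') (ρ : Path (V 0) fs r') →
                       (∀ v → OnPath π v ⊎ OnPath ρ v) → Explores (twoAgents es fs)
  explores-twoAgents π ρ cover = visits⇒explores
    (visits-invoke (visits-walk refl π (visits-invoke (visits-walk-end refl ρ))))
    (λ v → [ inj₂ , inj₁ ]′ (cover v))

  explores-outAndBack : ∀ {es fs p' r'} (π : Path (V 0) es p') (ρ : Path (V 0) fs r') →
                        (∀ v → OnPath π v ⊎ OnPath ρ v) → Explores (outAndBack es fs)
  explores-outAndBack π ρ cover = explores-singleAgent (π ++ᵖ (reverseᵖ π ++ᵖ ρ))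
    (λ v → [ onPath-++ˡ π _ , onPath-++ʳ π _ ∘ onPath-++ʳ (reverseᵖ π) ρ ]′ (cover v))

  weight : List (Fin n) → ℚ
  weight = foldr (λ k r → w k + r) 0ℚ

  weight-++ : ∀ es fs → weight (es ++ fs) ≡ weight es + weight fs
  weight-++ []       fs = sym (ℚP.+-identityˡ (weight fs))
  weight-++ (k ∷ es) fs = trans (cong (w k +_) (weight-++ es fs)) (sym (ℚP.+-assoc (w k) (weight es) (weight fs)))

  weight-reverse : ∀ es → weight (reverse es) ≡ weight es
  weight-reverse []       = refl
  weight-reverse (k ∷ es) = begin
    weight (reverse (k ∷ es))         ≡⟨ cong weight (LP.unfold-reverse k es) ⟩
    weight (reverse es ++ k ∷ [])     ≡⟨ weight-++ (reverse es) (k ∷ []) ⟩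
    weight (reverse es) + (w k + 0ℚ)  ≡⟨ cong₂ _+_ (weight-reverse es) (ℚP.+-identityʳ (w k)) ⟩
    weight es + w k                   ≡⟨ ℚP.+-comm (weight es) (w k) ⟩
    w k + weight es                   ∎
    where open ≡-Reasoning

  cost-++ : ∀ ms ms' → cost (ms ++ ms') ≡ cost ms + cost ms'
  cost-++ []       ms' = sym (ℚP.+-identityˡ (cost ms'))
  cost-++ (m ∷ ms) ms' = trans (cong (moveCost m +_) (cost-++ ms ms')) (sym (ℚP.+-assoc (moveCost m) (cost ms) (cost ms')))

  cost-walk : ∀ a es → cost (walk a es) ≡ weight es
  cost-walk a []       = refl
  cost-walk a (k ∷ es) = cong (w k +_) (cost-walk a es)

  cost-singleAgent : ∀ es → cost (singleAgent es) ≡ q + weight es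
  cost-singleAgent es = cong (q +_) (cost-walk 0 es)

  cost-twoAgents : ∀ es fs → cost (twoAgents es fs) ≡ q + q + (weight es + weight fs)
  cost-twoAgents es fs = begin
    q + cost (walk 0 es ++ (invoke ∷ walk 1 fs))      ≡⟨ cong (q +_) (cost-++ (walk 0 es) (invoke ∷ walk 1 fs)) ⟩
    q + (cost (walk 0 es) + (q + cost (walk 1 fs)))   ≡⟨ cong₂ (λ x y → q + (x + (q + y))) (cost-walk 0 es) (cost-walk 1 fs) ⟩
    q + (weight es + (q + weight fs))                 ≡⟨ solve 3 (λ q x y → q :+ (x :+ (q :+ y)) := q :+ q :+ (x :+ y)) refl
                                                                 q (weight es) (weight fs) ⟩
    q + q + (weight es + weight fs)                   ∎
    where open ≡-Reasoning
          open +-*-Solver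

  cost-outAndBack : ∀ es fs → cost (outAndBack es fs) ≡ q + weight es + (weight es + weight fs)
  cost-outAndBack es fs = begin
    q + cost (walk 0 (es ++ reverse es ++ fs))          ≡⟨ cong (q +_) (cost-walk 0 (es ++ reverse es ++ fs)) ⟩
    q + weight (es ++ reverse es ++ fs)                 ≡⟨ cong (q +_) (weight-++ es (reverse es ++ fs)) ⟩
    q + (weight es + weight (reverse es ++ fs))         ≡⟨ cong (λ x → q + (weight es + x)) (weight-++ (reverse es) fs) ⟩
    q + (weight es + (weight (reverse es) + weight fs)) ≡⟨ cong (λ x → q + (weight es + (x + weight fs))) (weight-reverse es) ⟩
    q + (weight es + (weight es + weight fs))           ≡⟨ sym (ℚP.+-assoc q (weight es) _) ⟩
    q + weight es + (weight es + weight fs)             ∎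
    where open ≡-Reasoning

  lowPath : ∀ i → Path (V 0) (lowEdges i) (V (toℕ i))
  lowPath i = subst (λ es → Path (V 0) es (V (toℕ i))) (sym (LP.map-upTo V (toℕ i))) (sequencePath V V (toℕ i) crosses)
    where crosses : ∀ k → k ℕ.< toℕ i → across (V k) (V k) ≡ just (V (suc k))
          crosses k k<i = trans (across-forward (V k)) (cong just (nextV-V (ℕP.<-trans k<i (toℕ<n i))))

  -- The vertices v_0, v_{n-1}, v_{n-2}, … of P_{C_i}(v_0, v_{i+1}); index 0 gives V 0 rather than V n,
  -- so that the path starts at the homebase itself.
  highVertex : ℕ → Fin n
  highVertex zero    = V 0
  highVertex (suc k) = V (n ∸ suc k)

  highVertex≡nextV : ∀ k → k ℕ.< n → highVertex k ≡ nextV (V (n ∸ suc k))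
  highVertex≡nextV zero    _     = sym nextV-last
  highVertex≡nextV (suc k) k+1<n =
    sym (trans (nextV-V (s≤s (ℕP.m∸n≤m N (suc k)))) (cong V (sym (ℕP.+-∸-assoc 1 k+1<n))))

  highPath : ∀ i → Path (V 0) (highEdges i) (highVertex (n ∸ suc (toℕ i)))
  highPath i = subst (λ es → Path (V 0) es (highVertex t)) (sym (LP.map-upTo (λ k → V (n ∸ suc k)) t))
    (sequencePath highVertex (λ k → V (n ∸ suc k)) t crosses)
    where
      t : ℕ
      t = n ∸ suc (toℕ i)
      crosses : ∀ k → k ℕ.< t → across (V (n ∸ suc k)) (highVertex k) ≡ just (highVertex (suc k))
      crosses k k<t = subst (λ v → across (V (n ∸ suc k)) v ≡ just (V (n ∸ suc k)))
        (sym (highVertex≡nextV k (ℕP.<-≤-trans k<t (ℕP.m∸n≤m n (suc (toℕ i)))))) (across-backward _)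

  highVertex-n∸ : ∀ {x} → x ℕ.< n → highVertex (n ∸ x) ≡ V x
  highVertex-n∸ {x} x<n with n ∸ x in eq
  ... | zero  = ⊥-elim (ℕP.<-irrefl (sym eq) (ℕP.m<n⇒0<n∸m x<n))
  ... | suc k = cong V (trans (cong (n ∸_) (sym eq)) (ℕP.m∸[m∸n]≡n (ℕP.<⇒≤ x<n)))

  onLowPath : ∀ i v → toℕ v ℕ.≤ toℕ i → OnPath (lowPath i) v
  onLowPath i v v≤i = onPath-subst _ _ (subst (OnPath _) (V-toℕ v) (onPath-sequence V V (toℕ i) _ v≤i))

  onHighPath : ∀ i v → toℕ i ℕ.< toℕ v → OnPath (highPath i) v
  onHighPath i v i<v = onPath-subst _ _
    (subst (OnPath _) (trans (highVertex-n∸ (toℕ<n v)) (V-toℕ v))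
      (onPath-sequence highVertex (λ k → V (n ∸ suc k)) (n ∸ suc (toℕ i)) _ (ℕP.∸-monoʳ-≤ n i<v)))

  onLowPath⊎onHighPath : ∀ i v → OnPath (lowPath i) v ⊎ OnPath (highPath i) v
  onLowPath⊎onHighPath i v with toℕ v ℕ.≤? toℕ i
  ... | yes v≤i = inj₁ (onLowPath i v v≤i)
  ... | no v≰i  = inj₂ (onHighPath i v (ℕP.≰⇒> v≰i))

  onHighPath-first : ∀ i → toℕ i ≡ 0 → ∀ v → OnPath (highPath i) v
  onHighPath-first i i≡0 v with toℕ v ℕ.≤? toℕ i
  ... | yes v≤i = subst (OnPath (highPath i)) (sym (toℕ-injective (ℕP.n≤0⇒n≡0 (subst (toℕ v ℕ.≤_) i≡0 v≤i))))
                    (onPath-start (highPath i))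
  ... | no v≰i  = onHighPath i v (ℕP.≰⇒> v≰i)

  onLowPath-last : ∀ i → toℕ i ≡ N → ∀ v → OnPath (lowPath i) v
  onLowPath-last i i≡N v = onLowPath i v (subst (toℕ v ℕ.≤_) (sym i≡N) (ℕP.≤-pred (toℕ<n v)))

  weight-downward : ∀ a m → a ℕ.+ m ≡ n → weight (applyUpTo (λ k → V (n ∸ suc k)) m) ≡ arc a m
  weight-downward a zero    _     = refl
  weight-downward a (suc m) a+m≡n = begin
    weight (applyUpTo f (suc m))                 ≡⟨ cong weight (sym (LP.applyUpTo-∷ʳ f m)) ⟩
    weight (applyUpTo f m ++ f m ∷ [])           ≡⟨ weight-++ (applyUpTo f m) (f m ∷ []) ⟩
    weight (applyUpTo f m) + (w (f m) + 0ℚ)      ≡⟨ cong₂ _+_ (weight-downward (suc a) m (trans (sym (ℕP.+-suc a m)) a+m≡n))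
                                                          (trans (ℚP.+-identityʳ (w (f m))) (cong wN n∸1+m≡a)) ⟩
    arc (suc a) m + wN a                         ≡⟨ ℚP.+-comm (arc (suc a) m) (wN a) ⟩
    arc a (suc m)                                ∎
    where
      open ≡-Reasoning
      f : ℕ → Fin n
      f k = V (n ∸ suc k)
      n∸1+m≡a : n ∸ suc m ≡ a
      n∸1+m≡a = trans (cong (_∸ suc m) (sym a+m≡n)) (ℕP.m+n∸n≡m a (suc m))

  weight-lowEdges : ∀ i → weight (lowEdges i) ≡ dLo i
  weight-lowEdges i = trans (cong weight (LP.map-upTo V (toℕ i)))
    (trans (foldr-applyUpTo≡arc w V 0 (toℕ i) (λ k → refl)) (sym (dLo≡arcTo i)))

  weight-highEdges : ∀ i → weight (highEdges i) ≡ dHi i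
  weight-highEdges i = trans (cong weight (LP.map-upTo _ (n ∸ suc (toℕ i))))
    (trans (weight-downward (suc (toℕ i)) _ (ℕP.m+[n∸m]≡n (toℕ<n i))) (sym (dHi≡arcFrom i)))

  edgesToMin edgesToMax : Fin n → Bool → List (Fin n)
  edgesToMin i b = if b then highEdges i else lowEdges i
  edgesToMax i b = if b then lowEdges i else highEdges i

  distToMin : Fin n → Bool → ℚ
  distToMin i b = if b then dHi i else dLo i

  explores-twoAgents-min : ∀ i b → Explores (twoAgents (edgesToMin i b) (edgesToMax i b))
  explores-twoAgents-min i false = explores-twoAgents (lowPath i) (highPath i) (onLowPath⊎onHighPath i)
  explores-twoAgents-min i true  = explores-twoAgents (highPath i) (lowPath i) (swap ∘ onLowPath⊎onHighPath i)

  explores-outAndBack-min : ∀ i b → Explores (outAndBack (edgesToMin i b) (edgesToMax i b))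
  explores-outAndBack-min i false = explores-outAndBack (lowPath i) (highPath i) (onLowPath⊎onHighPath i)
  explores-outAndBack-min i true  = explores-outAndBack (highPath i) (lowPath i) (swap ∘ onLowPath⊎onHighPath i)

  ringOffline-explores : ∀ i b → Explores (ringOffline i b)
  ringOffline-explores i b with toℕ i ℕ.≡ᵇ 0 in first | toℕ i ℕ.≡ᵇ N in last
  ... | true  | _     = explores-singleAgent (highPath i) (onHighPath-first i (≡ᵇ⇒≡ first))
  ... | false | true  = explores-singleAgent (lowPath i) (onLowPath-last i (≡ᵇ⇒≡ last))
  ... | false | false with does ((q + q + wC i) <? (q + distToMin i b + wC i))
  ...   | true  = explores-twoAgents-min i b
  ...   | false = explores-outAndBack-min i b

  weight-toMin : ∀ i b → weight (edgesToMin i b) ≡ distToMin i b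
  weight-toMin i false = weight-lowEdges i
  weight-toMin i true  = weight-highEdges i

  weight-toMin+toMax : ∀ i b → weight (edgesToMin i b) + weight (edgesToMax i b) ≡ wC i
  weight-toMin+toMax i false = trans (cong₂ _+_ (weight-lowEdges i) (weight-highEdges i)) (sym (wC≡dLo+dHi i))
  weight-toMin+toMax i true  = trans (cong₂ _+_ (weight-highEdges i) (weight-lowEdges i))
                                     (trans (ℚP.+-comm (dHi i) (dLo i)) (sym (wC≡dLo+dHi i)))

  distToMin≡⊓ : ∀ i b → ValidMinChoice i b → distToMin i b ≡ dLo i ⊓ dHi i
  distToMin≡⊓ i false dLo≤dHi = sym (ℚP.p≤q⇒p⊓q≡p dLo≤dHi)
  distToMin≡⊓ i true  dHi≤dLo = sym (ℚP.p≥q⇒p⊓q≡q dHi≤dLo)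

  cost-first : ∀ i → toℕ i ≡ 0 → cost (singleAgent (highEdges i)) ≡ q + wC i
  cost-first i i≡0 = begin
    cost (singleAgent (highEdges i))   ≡⟨ trans (cost-singleAgent (highEdges i)) (cong (q +_) (weight-highEdges i)) ⟩
    q + dHi i                          ≡⟨ cong (q +_) (sym (ℚP.+-identityˡ (dHi i))) ⟩
    q + (0ℚ + dHi i)                   ≡⟨ cong (λ d → q + (d + dHi i)) (sym (trans (dLo≡arcTo i) (cong arcTo i≡0))) ⟩
    q + (dLo i + dHi i)                ≡⟨ cong (q +_) (sym (wC≡dLo+dHi i)) ⟩
    q + wC i                           ∎
    where open ≡-Reasoning

  cost-last : ∀ i → toℕ i ≡ N → cost (singleAgent (lowEdges i)) ≡ q + wC i
  cost-last i i≡N = begin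
    cost (singleAgent (lowEdges i))    ≡⟨ trans (cost-singleAgent (lowEdges i)) (cong (q +_) (weight-lowEdges i)) ⟩
    q + dLo i                          ≡⟨ cong (q +_) (sym (ℚP.+-identityʳ (dLo i))) ⟩
    q + (dLo i + 0ℚ)                   ≡⟨ cong (λ d → q + (dLo i + d)) (sym dHi≡0) ⟩
    q + (dLo i + dHi i)                ≡⟨ cong (q +_) (sym (wC≡dLo+dHi i)) ⟩
    q + wC i                           ∎
    where open ≡-Reasoning
          dHi≡0 : dHi i ≡ 0ℚ
          dHi≡0 = trans (dHi≡arcFrom i) (trans (cong (arcFrom ∘ suc) i≡N) arcFrom-n)

  ringOffline-cost : ∀ i b → ValidMinChoice i b → cost (ringOffline i b) ≡ c i
  ringOffline-cost i b valid with toℕ i ℕ.≡ᵇ 0 in first | toℕ i ℕ.≡ᵇ N in last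
  ... | true  | _     = cost-first i (≡ᵇ⇒≡ first)
  ... | false | true  = cost-last i (≡ᵇ⇒≡ last)
  ... | false | false = begin
    cost (if does (x <? y) then twoAgents es fs else outAndBack es fs)
      ≡⟨ if-float cost (does (x <? y)) ⟩
    (if does (x <? y) then cost (twoAgents es fs) else cost (outAndBack es fs))
      ≡⟨ cong₂ (if does (x <? y) then_else_) cost-twoAgents≡x cost-outAndBack≡y ⟩
    (if does (x <? y) then x else y)
      ≡⟨ if-<?≡⊓ (x <? y) ⟩
    x ⊓ y
      ≡⟨ cong (λ d → x ⊓ (q + d + wC i)) (distToMin≡⊓ i b valid) ⟩
    x ⊓ (q + (dLo i ⊓ dHi i) + wC i)
      ∎
    where
      open ≡-Reasoning
      es fs : List (Fin n)
      es = edgesToMin i b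
      fs = edgesToMax i b
      x y : ℚ
      x = q + q + wC i
      y = q + distToMin i b + wC i
      cost-twoAgents≡x : cost (twoAgents es fs) ≡ x
      cost-twoAgents≡x = trans (cost-twoAgents es fs) (cong (q + q +_) (weight-toMin+toMax i b))
      cost-outAndBack≡y : cost (outAndBack es fs) ≡ y
      cost-outAndBack≡y = trans (cost-outAndBack es fs)
                                (cong₂ (λ d s → q + d + s) (weight-toMin i b) (weight-toMin+toMax i b))

  ringOffline-optimal : (∀ k → 0ℚ ≤ℚ w k) → 0ℚ ≤ℚ q → ∀ i → (∀ j → c i ≤ℚ c j) → ∀ b → ValidMinChoice i b →
                        CostOptimal (ringOffline i b)
  ringOffline-optimal w≥0 q≥0 i cᵢ-minimal b valid = ringOffline-explores i b , λ s explores →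
    let j , cⱼ≤cost = explores⇒cMin≤ w≥0 q≥0 {s} explores
    in ℚP.≤-trans (ℚP.≤-reflexive (ringOffline-cost i b valid)) (ℚP.≤-trans (cᵢ-minimal j) cⱼ≤cost)

mainTheorem1 : (n : ℕ) .{{_ : NonZero n}} → 3 ≤ n →
    (w : Fin n → ℚ) → ((k : Fin n) → 0ℚ <ℚ w k) →
    (q : ℚ) → 0ℚ ≤ℚ q →
    (i : Fin n) → ((j : Fin n) → Ring.c n w q i ≤ℚ Ring.c n w q j) →
    (b : Bool) → Ring.ValidMinChoice n w q i b →
    Ring.CostOptimal n w q (Ring.ringOffline n w q i b)
mainTheorem1 (suc (suc M)) _ w w>0 q q≥0 i cᵢ-minimal b valid =
  RingExploration.ringOffline-optimal M w q (λ k → ℚP.<⇒≤ (w>0 k)) q≥0 i cᵢ-minimal b valid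
mainTheorem1 (suc zero) (s≤s ())
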